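{- Let $F:\mathbb{X}\to\mathbb{Y}$ be a restriction functor between discrete inverse categories which preserves the inverse product structure. Then $F$ is faithful if and only if it is faithful on restriction idempotents.
   Context: Composition is diagrammatic ($fg$ = first $f$ then $g$). An inverse category is a category with an identity-on-objects involution $(-)^\circ:\mathbb{X}^{op}\to\mathbb{X}$ with $(c^\circ)^\circ=c$, $cc^\circ c=c$, $cc^\circ dd^\circ=dd^\circ cc^\circ$; it is a restriction category with $\overline c=cc^\circ$. A restriction functor preserves $\overline{(\cdot)}$; a restriction idempotent is $e$ with $e=\overline e$; $F$ is faithful on restriction idempotents if $F(e)=F(e')$ for parallel restriction idempotents implies $e=e'$. An inverse category has inverse products if it has a tensor product $\otimes$ preserving $(-)^\circ$ and a total natural transformation $\Delta_A:A\to A\otimes A$ which is cocommutative, coassociative, with $(\Delta_A,\Delta_A^\circ)$ semi-Frobenius ($(\Delta_A\otimes1)a(1\otimes\Delta_A^\circ)=\Delta_A^\circ\Delta_A=(1\otimes\Delta_A)a^\circ(\Delta_A^\circ\otimes1)$), and satisfying uniform copying $\Delta_{A\otimes B}=(\Delta_A\otimes\Delta_B)\mathsf{ex}_{A,B}$ with $\mathsf{ex}$ the canonical middle-exchange isomorphism. A discrete inverse category is an inverse category with inverse products; preserving the inverse product structure means preserving $\otimes$ and $\Delta$. -}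

module Defs where

open import Level using (Level; _⊔_) renaming (suc to lsuc)
open import Relation.Binary.PropositionalEquality using (_≡_)
open import Data.Product using (_×_; Σ)
open import Function.Bundles using (_⇔_)

-- Composition is DIAGRAMMATIC throughout:  f ▸ g  =  "first f, then g".
-- Hom-sets are ordinary sets; equality of morphisms is propositional equality.

record Category (o h : Level) : Set (lsuc (o ⊔ h)) where
  infixl 7 _▸_
  field
    Obj  : Set o
    Hom  : Obj → Obj → Set h
    id   : ∀ {A} → Hom A A
    _▸_  : ∀ {A B C} → Hom A B → Hom B C → Hom A C
    idˡ  : ∀ {A B} (f : Hom A B) → id ▸ f ≡ f
    idʳ  : ∀ {A B} (f : Hom A B) → f ▸ id ≡ f
    assoc : ∀ {A B C D} (f : Hom A B) (g : Hom B C) (k : Hom C D) →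
            (f ▸ g) ▸ k ≡ f ▸ (g ▸ k)

record IsIso {o h} (C : Category o h) {A B : Category.Obj C}
             (f : Category.Hom C A B) : Set h where
  open Category C
  field
    inv  : Hom B A
    invˡ : f ▸ inv ≡ id
    invʳ : inv ▸ f ≡ id

record InverseCategory (o h : Level) : Set (lsuc (o ⊔ h)) where
  field
    cat : Category o h
  open Category cat public
  infix 9 _°
  field
    _°     : ∀ {A B} → Hom A B → Hom B A
    °-id   : ∀ {A} → id {A} ° ≡ id
    °-▸    : ∀ {A B C} (f : Hom A B) (g : Hom B C) → (f ▸ g) ° ≡ g ° ▸ f °
    °-invol : ∀ {A B} (c : Hom A B) → (c °) ° ≡ c
    c°c    : ∀ {A B} (c : Hom A B) → c ▸ c ° ▸ c ≡ c
    °-comm : ∀ {A B C} (c : Hom A B) (d : Hom A C) →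
             c ▸ c ° ▸ (d ▸ d °) ≡ d ▸ d ° ▸ (c ▸ c °)

  restr : ∀ {A B} → Hom A B → Hom A A
  restr c = c ▸ c °

  IsRestrictionIdempotent : ∀ {A} → Hom A A → Set h
  IsRestrictionIdempotent e = e ≡ restr e

  IsTotal : ∀ {A B} → Hom A B → Set h
  IsTotal f = restr f ≡ id

record InverseTensor {o h} (X : InverseCategory o h) : Set (lsuc (o ⊔ h)) where
  open InverseCategory X
  infixr 8 _⊗₀_ _⊗₁_
  field
    _⊗₀_ : Obj → Obj → Obj
    _⊗₁_ : ∀ {A B C D} → Hom A B → Hom C D → Hom (A ⊗₀ C) (B ⊗₀ D)
    ⊗-id : ∀ {A B} → id {A} ⊗₁ id {B} ≡ id
    ⊗-▸  : ∀ {A B C A' B' C'} (f : Hom A B) (g : Hom B C)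
             (f' : Hom A' B') (g' : Hom B' C') →
           (f ▸ g) ⊗₁ (f' ▸ g') ≡ (f ⊗₁ f') ▸ (g ⊗₁ g')
    ⊗-° : ∀ {A B C D} (f : Hom A B) (g : Hom C D) → (f ⊗₁ g) ° ≡ f ° ⊗₁ g °
    unit : Obj
    α : ∀ A B C → Hom ((A ⊗₀ B) ⊗₀ C) (A ⊗₀ (B ⊗₀ C))
    λ⊗ : ∀ A → Hom (unit ⊗₀ A) A
    ρ⊗ : ∀ A → Hom (A ⊗₀ unit) A
    σ : ∀ A B → Hom (A ⊗₀ B) (B ⊗₀ A)
    α-iso : ∀ A B C → IsIso cat (α A B C)
    λ-iso : ∀ A → IsIso cat (λ⊗ A)
    ρ-iso : ∀ A → IsIso cat (ρ⊗ A)
    α-nat : ∀ {A A' B B' C C'} (f : Hom A A') (g : Hom B B') (k : Hom C C') →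
            ((f ⊗₁ g) ⊗₁ k) ▸ α A' B' C' ≡ α A B C ▸ (f ⊗₁ (g ⊗₁ k))
    λ-nat : ∀ {A B} (f : Hom A B) → (id ⊗₁ f) ▸ λ⊗ B ≡ λ⊗ A ▸ f
    ρ-nat : ∀ {A B} (f : Hom A B) → (f ⊗₁ id) ▸ ρ⊗ B ≡ ρ⊗ A ▸ f
    σ-nat : ∀ {A A' B B'} (f : Hom A A') (g : Hom B B') →
            (f ⊗₁ g) ▸ σ A' B' ≡ σ A B ▸ (g ⊗₁ f)
    σ-invol : ∀ A B → σ A B ▸ σ B A ≡ id
    pentagon : ∀ A B C D →
      (α A B C ⊗₁ id {D}) ▸ α A (B ⊗₀ C) D ▸ (id {A} ⊗₁ α B C D)
        ≡ α (A ⊗₀ B) C D ▸ α A B (C ⊗₀ D)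
    triangle : ∀ A B →
      α A unit B ▸ (id {A} ⊗₁ λ⊗ B) ≡ ρ⊗ A ⊗₁ id {B}
    hexagon : ∀ A B C →
      α A B C ▸ σ A (B ⊗₀ C) ▸ α B C A
        ≡ (σ A B ⊗₁ id {C}) ▸ α B A C ▸ (id {B} ⊗₁ σ A C)

  ex : ∀ A B → Hom ((A ⊗₀ A) ⊗₀ (B ⊗₀ B)) ((A ⊗₀ B) ⊗₀ (A ⊗₀ B))
  ex A B = α A A (B ⊗₀ B)
         ▸ (id {A} ⊗₁ (α A B B) °)
         ▸ (id {A} ⊗₁ (σ A B ⊗₁ id {B}))
         ▸ (id {A} ⊗₁ α B A B)
         ▸ (α A B (A ⊗₀ B)) °

record InverseProducts {o h} (X : InverseCategory o h) : Set (lsuc (o ⊔ h)) where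
  open InverseCategory X
  field
    tensor : InverseTensor X
  open InverseTensor tensor public
  field
    Δ : ∀ A → Hom A (A ⊗₀ A)
    Δ-total : ∀ A → IsTotal (Δ A)
    Δ-nat : ∀ {A B} (f : Hom A B) → f ▸ Δ B ≡ Δ A ▸ (f ⊗₁ f)
    Δ-cocomm : ∀ A → Δ A ▸ σ A A ≡ Δ A
    Δ-coassoc : ∀ A → Δ A ▸ (Δ A ⊗₁ id {A}) ▸ α A A A ≡ Δ A ▸ (id {A} ⊗₁ Δ A)
    semiFrobeniusˡ : ∀ A →
      (Δ A ⊗₁ id {A}) ▸ α A A A ▸ (id {A} ⊗₁ (Δ A) °) ≡ (Δ A) ° ▸ Δ A
    semiFrobeniusʳ : ∀ A →
      (Δ A) ° ▸ Δ A ≡ (id {A} ⊗₁ Δ A) ▸ (α A A A) ° ▸ ((Δ A) ° ⊗₁ id {A})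
    uniformCopying : ∀ A B → Δ (A ⊗₀ B) ≡ (Δ A ⊗₁ Δ B) ▸ ex A B

record DiscreteInverseCategory (o h : Level) : Set (lsuc (o ⊔ h)) where
  field
    invCat : InverseCategory o h
    invProducts : InverseProducts invCat
  open InverseCategory invCat public
  open InverseProducts invProducts public

record RestrictionFunctor {o h o' h'} (X : DiscreteInverseCategory o h)
       (Y : DiscreteInverseCategory o' h') : Set (o ⊔ h ⊔ o' ⊔ h') where
  private
    module X = DiscreteInverseCategory X
    module Y = DiscreteInverseCategory Y
  field
    F₀ : X.Obj → Y.Obj
    F₁ : ∀ {A B} → X.Hom A B → Y.Hom (F₀ A) (F₀ B)
    F-id : ∀ {A} → F₁ (X.id {A}) ≡ Y.id
    F-▸ : ∀ {A B C} (f : X.Hom A B) (g : X.Hom B C) → F₁ (f X.▸ g) ≡ F₁ f Y.▸ F₁ g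
    F-restr : ∀ {A B} (f : X.Hom A B) → F₁ (X.restr f) ≡ Y.restr (F₁ f)

-- F preserves the inverse product structure: it preserves ⊗ (as a strong
-- symmetric monoidal functor, with coherent comparison isomorphisms φ, φ₀)
-- and preserves Δ (F(Δ_A) = Δ_{FA} followed by the comparison iso).
record PreservesInverseProducts {o h o' h'} {X : DiscreteInverseCategory o h}
       {Y : DiscreteInverseCategory o' h'} (F : RestrictionFunctor X Y)
       : Set (o ⊔ h ⊔ o' ⊔ h') where
  private
    module X = DiscreteInverseCategory X
    module Y = DiscreteInverseCategory Y
  open RestrictionFunctor F
  field
    φ : ∀ A B → Y.Hom (F₀ A Y.⊗₀ F₀ B) (F₀ (A X.⊗₀ B))
    φ₀ : Y.Hom Y.unit (F₀ X.unit)
    φ-iso : ∀ A B → IsIso Y.cat (φ A B)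
    φ₀-iso : IsIso Y.cat φ₀
    φ-nat : ∀ {A A' B B'} (f : X.Hom A A') (g : X.Hom B B') →
            (F₁ f Y.⊗₁ F₁ g) Y.▸ φ A' B' ≡ φ A B Y.▸ F₁ (f X.⊗₁ g)
    φ-α : ∀ A B C →
      (φ A B Y.⊗₁ Y.id) Y.▸ φ (A X.⊗₀ B) C Y.▸ F₁ (X.α A B C)
        ≡ Y.α (F₀ A) (F₀ B) (F₀ C) Y.▸ (Y.id Y.⊗₁ φ B C) Y.▸ φ A (B X.⊗₀ C)
    φ-λ : ∀ A → (φ₀ Y.⊗₁ Y.id) Y.▸ φ X.unit A Y.▸ F₁ (X.λ⊗ A) ≡ Y.λ⊗ (F₀ A)
    φ-ρ : ∀ A → (Y.id Y.⊗₁ φ₀) Y.▸ φ A X.unit Y.▸ F₁ (X.ρ⊗ A) ≡ Y.ρ⊗ (F₀ A)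
    φ-σ : ∀ A B → Y.σ (F₀ A) (F₀ B) Y.▸ φ B A ≡ φ A B Y.▸ F₁ (X.σ A B)
    F-Δ : ∀ A → F₁ (X.Δ A) ≡ Y.Δ (F₀ A) Y.▸ φ A A

module _ {o h o' h'} {X : DiscreteInverseCategory o h}
         {Y : DiscreteInverseCategory o' h'} (F : RestrictionFunctor X Y) where
  private
    module X = DiscreteInverseCategory X
  open RestrictionFunctor F

  Faithful : Set (o ⊔ h ⊔ h')
  Faithful = ∀ {A B} (f g : X.Hom A B) → F₁ f ≡ F₁ g → f ≡ g

  FaithfulOnRestrictionIdempotents : Set (o ⊔ h ⊔ h')
  FaithfulOnRestrictionIdempotents =
    ∀ {A} (e e' : X.Hom A A) → X.IsRestrictionIdempotent e →
    X.IsRestrictionIdempotent e' → F₁ e ≡ F₁ e' → e ≡ e'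

-- Parallel f, g are equal once g ▸ f ° = restr f and restr g = restr f.  If F f = F g,
-- faithfulness on restriction idempotents yields the latter and F (g ▸ f °) = F (restr f),
-- so it remains to see that x = g ▸ f ° is a restriction idempotent.  The inverse products
-- detect this through restriction idempotents: by the semi-Frobenius law the meet
-- id ∩ x = Δ ▸ (id ⊗ x) ▸ Δ ° is idempotent, and it equals x as soon as it has the same
-- restriction as Δ ▸ (id ⊗ x), an equation between restriction idempotents that F reflects.
module Submission where

open import Defs
open import Level using (Level)
open import Function.Bundles using (_⇔_; mk⇔)
open import Relation.Binary.PropositionalEquality
open ≡-Reasoning

module CategoryProperties {o h} (C : Category o h) where
  open Category C

  iso-cancelˡ : ∀ {A B D} {f : Hom A B} → IsIso C f → {u v : Hom B D} →
                f ▸ u ≡ f ▸ v → u ≡ v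
  iso-cancelˡ {f = f} iso {u} {v} fu≡fv = begin
    u                ≡⟨ sym (idˡ u) ⟩
    id ▸ u           ≡⟨ cong (_▸ u) (sym invʳ) ⟩
    inv ▸ f ▸ u      ≡⟨ assoc inv f u ⟩
    inv ▸ (f ▸ u)    ≡⟨ cong (inv ▸_) fu≡fv ⟩
    inv ▸ (f ▸ v)    ≡⟨ sym (assoc inv f v) ⟩
    inv ▸ f ▸ v      ≡⟨ cong (_▸ v) invʳ ⟩
    id ▸ v           ≡⟨ idˡ v ⟩
    v                ∎
    where open IsIso iso

module InverseCategoryProperties {o h} (X : InverseCategory o h) where
  open InverseCategory X

  restr-id : ∀ {A} → restr (id {A}) ≡ id
  restr-id = trans (cong (id ▸_) °-id) (idˡ id)

  restr-° : ∀ {A B} (f : Hom A B) → restr (f °) ≡ f ° ▸ f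
  restr-° f = cong (f ° ▸_) (°-invol f)

  restr-▸ : ∀ {A B C} (f : Hom A B) (g : Hom B C) → restr (f ▸ g) ≡ f ▸ restr g ▸ f °
  restr-▸ f g = begin
    f ▸ g ▸ (f ▸ g) °      ≡⟨ cong (f ▸ g ▸_) (°-▸ f g) ⟩
    f ▸ g ▸ (g ° ▸ f °)    ≡⟨ sym (assoc (f ▸ g) (g °) (f °)) ⟩
    f ▸ g ▸ g ° ▸ f °      ≡⟨ cong (_▸ f °) (assoc f g (g °)) ⟩
    f ▸ restr g ▸ f °      ∎

  restr-isRestrictionIdempotent : ∀ {A B} (c : Hom A B) → IsRestrictionIdempotent (restr c)
  restr-isRestrictionIdempotent c = sym (begin
    restr c ▸ (c ▸ c °) °      ≡⟨ cong (restr c ▸_) (°-▸ c (c °)) ⟩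
    restr c ▸ (c ° ° ▸ c °)    ≡⟨ cong (λ z → restr c ▸ (z ▸ c °)) (°-invol c) ⟩
    restr c ▸ (c ▸ c °)        ≡⟨ sym (assoc (restr c) c (c °)) ⟩
    c ▸ c ° ▸ c ▸ c °          ≡⟨ cong (_▸ c °) (c°c c) ⟩
    restr c                    ∎)

  module _ {A} {e : Hom A A} (isRI : IsRestrictionIdempotent e) where

    restrictionIdempotent-° : e ° ≡ e
    restrictionIdempotent-° = begin
      e °            ≡⟨ cong _° isRI ⟩
      (e ▸ e °) °    ≡⟨ °-▸ e (e °) ⟩
      e ° ° ▸ e °    ≡⟨ cong (_▸ e °) (°-invol e) ⟩
      e ▸ e °        ≡⟨ sym isRI ⟩
      e              ∎

    restrictionIdempotent-idempotent : e ▸ e ≡ e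
    restrictionIdempotent-idempotent =
      trans (cong (e ▸_) (sym restrictionIdempotent-°)) (sym isRI)

  restrictionIdempotent-comm : ∀ {A} {a b : Hom A A} → IsRestrictionIdempotent a →
                               IsRestrictionIdempotent b → a ▸ b ≡ b ▸ a
  restrictionIdempotent-comm {a = a} {b} isRIa isRIb = begin
    a ▸ b              ≡⟨ cong₂ _▸_ isRIa isRIb ⟩
    restr a ▸ restr b  ≡⟨ °-comm a b ⟩
    restr b ▸ restr a  ≡⟨ sym (cong₂ _▸_ isRIb isRIa) ⟩
    b ▸ a              ∎

  restrictionIdempotent-▸ : ∀ {A} {a b : Hom A A} → IsRestrictionIdempotent a →
                            IsRestrictionIdempotent b → IsRestrictionIdempotent (a ▸ b)
  restrictionIdempotent-▸ {a = a} {b} isRIa isRIb = sym (begin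
    restr (a ▸ b)    ≡⟨ restr-▸ a b ⟩
    a ▸ restr b ▸ a ° ≡⟨ cong₂ (λ u v → a ▸ u ▸ v) (sym isRIb) (restrictionIdempotent-° isRIa) ⟩
    a ▸ b ▸ a        ≡⟨ assoc a b a ⟩
    a ▸ (b ▸ a)      ≡⟨ cong (a ▸_) (restrictionIdempotent-comm isRIb isRIa) ⟩
    a ▸ (a ▸ b)      ≡⟨ sym (assoc a a b) ⟩
    a ▸ a ▸ b        ≡⟨ cong (_▸ b) (restrictionIdempotent-idempotent isRIa) ⟩
    a ▸ b            ∎)

  -- t ° = (t ° ▸ t) ▸ (t ▸ t °) is a product of restriction idempotents.
  idempotent⇒restrictionIdempotent : ∀ {A} {t : Hom A A} → t ▸ t ≡ t →
                                     IsRestrictionIdempotent t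
  idempotent⇒restrictionIdempotent {t = t} tt≡t = begin
    t          ≡⟨ sym tt≡t ⟩
    t ▸ t      ≡⟨ cong (t ▸_) t≡t° ⟩
    t ▸ t °    ∎
    where
      t°-factor : t ° ≡ restr (t °) ▸ restr t
      t°-factor = begin
        t °                    ≡⟨ sym (c°c (t °)) ⟩
        t ° ▸ t ° ° ▸ t °      ≡⟨ cong (λ z → t ° ▸ z ▸ t °) (trans (°-invol t) (sym tt≡t)) ⟩
        t ° ▸ (t ▸ t) ▸ t °    ≡⟨ cong (_▸ t °) (sym (assoc (t °) t t)) ⟩
        t ° ▸ t ▸ t ▸ t °      ≡⟨ assoc (t ° ▸ t) t (t °) ⟩
        t ° ▸ t ▸ restr t      ≡⟨ cong (_▸ restr t) (sym (restr-° t)) ⟩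
        restr (t °) ▸ restr t  ∎
      t°-isRI : IsRestrictionIdempotent (t °)
      t°-isRI = subst IsRestrictionIdempotent (sym t°-factor)
        (restrictionIdempotent-▸ (restr-isRestrictionIdempotent (t °))
                                 (restr-isRestrictionIdempotent t))
      t≡t° : t ≡ t °
      t≡t° = trans (sym (°-invol t)) (restrictionIdempotent-° t°-isRI)

  ▸-restr : ∀ {A B C} (f : Hom A B) (g : Hom B C) → f ▸ restr g ≡ restr (f ▸ g) ▸ f
  ▸-restr f g = sym (begin
    restr (f ▸ g) ▸ f                ≡⟨ cong (_▸ f) (restr-▸ f g) ⟩
    f ▸ restr g ▸ f ° ▸ f            ≡⟨ assoc (f ▸ restr g) (f °) f ⟩
    f ▸ restr g ▸ (f ° ▸ f)          ≡⟨ cong (f ▸ restr g ▸_) (sym (restr-° f)) ⟩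
    f ▸ restr g ▸ restr (f °)        ≡⟨ assoc f (restr g) (restr (f °)) ⟩
    f ▸ (restr g ▸ restr (f °))      ≡⟨ cong (f ▸_) (°-comm g (f °)) ⟩
    f ▸ (restr (f °) ▸ restr g)      ≡⟨ sym (assoc f (restr (f °)) (restr g)) ⟩
    f ▸ restr (f °) ▸ restr g        ≡⟨ cong (λ z → f ▸ z ▸ restr g) (restr-° f) ⟩
    f ▸ (f ° ▸ f) ▸ restr g          ≡⟨ cong (_▸ restr g) (sym (assoc f (f °) f)) ⟩
    f ▸ f ° ▸ f ▸ restr g            ≡⟨ cong (_▸ restr g) (c°c f) ⟩
    f ▸ restr g                      ∎)

  ▸-restr-absorb : ∀ {A B C} (f : Hom A B) (g : Hom B C) → restr (f ▸ g) ≡ restr f →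
                   f ▸ restr g ≡ f
  ▸-restr-absorb f g eq = trans (▸-restr f g) (trans (cong (_▸ f) eq) (c°c f))

  total⇒monic : ∀ {A B C} {m : Hom B C} → IsTotal m → {a b : Hom A B} →
                a ▸ m ≡ b ▸ m → a ≡ b
  total⇒monic {m = m} m-total {a} {b} am≡bm = begin
    a               ≡⟨ sym (idʳ a) ⟩
    a ▸ id          ≡⟨ cong (a ▸_) (sym m-total) ⟩
    a ▸ (m ▸ m °)   ≡⟨ sym (assoc a m (m °)) ⟩
    a ▸ m ▸ m °     ≡⟨ cong (_▸ m °) am≡bm ⟩
    b ▸ m ▸ m °     ≡⟨ assoc b m (m °) ⟩
    b ▸ (m ▸ m °)   ≡⟨ cong (b ▸_) m-total ⟩
    b ▸ id          ≡⟨ idʳ b ⟩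
    b               ∎

  ≡-from-▸° : ∀ {A B} {f g : Hom A B} → g ▸ f ° ≡ restr f → restr g ≡ restr f → f ≡ g
  ≡-from-▸° {f = f} {g} gf°≡rf rg≡rf = begin
    f                      ≡⟨ sym (c°c f) ⟩
    restr f ▸ f            ≡⟨ cong (_▸ f) (sym gf°≡rf) ⟩
    g ▸ f ° ▸ f            ≡⟨ assoc g (f °) f ⟩
    g ▸ (f ° ▸ f)          ≡⟨ cong (g ▸_) (sym (restr-° f)) ⟩
    g ▸ restr (f °)        ≡⟨ ▸-restr g (f °) ⟩
    restr (g ▸ f °) ▸ g    ≡⟨ cong (λ z → restr z ▸ g) gf°≡rf ⟩
    restr (restr f) ▸ g    ≡⟨ cong (_▸ g) (sym (restr-isRestrictionIdempotent f)) ⟩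
    restr f ▸ g            ≡⟨ cong (_▸ g) (sym rg≡rf) ⟩
    restr g ▸ g            ≡⟨ c°c g ⟩
    g                      ∎

module DiscreteInverseCategoryProperties {o h} (X : DiscreteInverseCategory o h) where
  open DiscreteInverseCategory X
  open InverseCategoryProperties invCat

  infixl 6 _∩_
  _∩_ : ∀ {A B} → Hom A B → Hom A B → Hom A B
  f ∩ g = Δ _ ▸ (f ⊗₁ g) ▸ Δ _ °

  ⊗-serialize₁₂ : ∀ {A B C D} (f : Hom A B) (g : Hom C D) → f ⊗₁ g ≡ (f ⊗₁ id) ▸ (id ⊗₁ g)
  ⊗-serialize₁₂ f g = trans (sym (cong₂ _⊗₁_ (idʳ f) (idˡ g))) (⊗-▸ f id id g)

  restr-⊗ : ∀ {A B C D} (f : Hom A B) (g : Hom C D) → restr (f ⊗₁ g) ≡ restr f ⊗₁ restr g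
  restr-⊗ f g = trans (cong ((f ⊗₁ g) ▸_) (⊗-° f g)) (sym (⊗-▸ f (f °) g (g °)))

  restr-Δ▸⊗ : ∀ {A B C} (f : Hom A B) (g : Hom A C) →
              restr (Δ A ▸ (f ⊗₁ g)) ≡ Δ A ▸ (restr f ⊗₁ restr g) ▸ Δ A °
  restr-Δ▸⊗ {A} f g = trans (restr-▸ (Δ A) (f ⊗₁ g)) (cong (λ z → Δ A ▸ z ▸ Δ A °) (restr-⊗ f g))

  Δ-monic : ∀ {A B} {a b : Hom A B} → a ▸ Δ B ≡ b ▸ Δ B → a ≡ b
  Δ-monic = total⇒monic (Δ-total _)

  Δ▸⊗-swap : ∀ {A B} {k a b : Hom A B} →
             k ▸ Δ B ≡ Δ A ▸ (a ⊗₁ b) → k ▸ Δ B ≡ Δ A ▸ (b ⊗₁ a)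
  Δ▸⊗-swap {A} {B} {k} {a} {b} k▸Δ≡ = begin
    k ▸ Δ B                    ≡⟨ cong (k ▸_) (sym (Δ-cocomm B)) ⟩
    k ▸ (Δ B ▸ σ B B)          ≡⟨ sym (assoc k (Δ B) (σ B B)) ⟩
    k ▸ Δ B ▸ σ B B            ≡⟨ cong (_▸ σ B B) k▸Δ≡ ⟩
    Δ A ▸ (a ⊗₁ b) ▸ σ B B     ≡⟨ assoc (Δ A) (a ⊗₁ b) (σ B B) ⟩
    Δ A ▸ ((a ⊗₁ b) ▸ σ B B)   ≡⟨ cong (Δ A ▸_) (σ-nat a b) ⟩
    Δ A ▸ (σ A A ▸ (b ⊗₁ a))   ≡⟨ sym (assoc (Δ A) (σ A A) (b ⊗₁ a)) ⟩
    Δ A ▸ σ A A ▸ (b ⊗₁ a)     ≡⟨ cong (_▸ (b ⊗₁ a)) (Δ-cocomm A) ⟩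
    Δ A ▸ (b ⊗₁ a)             ∎

  ∩-▸-Δ : ∀ {A B} (a k : Hom A B) → (a ∩ k) ▸ Δ B ≡ Δ A ▸ (a ⊗₁ (a ∩ k))
  ∩-▸-Δ {A} {B} a k = begin
    Δ A ▸ (a ⊗₁ k) ▸ Δ B ° ▸ Δ B                  ≡⟨ assoc (Δ A ▸ (a ⊗₁ k)) (Δ B °) (Δ B) ⟩
    Δ A ▸ (a ⊗₁ k) ▸ (Δ B ° ▸ Δ B)                ≡⟨ cong (Δ A ▸ (a ⊗₁ k) ▸_) (sym (semiFrobeniusˡ B)) ⟩
    Δ A ▸ (a ⊗₁ k) ▸ (Δ B ⊗₁ id ▸ α B B B ▸ id ⊗₁ Δ B °)
      ≡⟨ assoc (Δ A) (a ⊗₁ k) _ ⟩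
    Δ A ▸ ((a ⊗₁ k) ▸ (Δ B ⊗₁ id ▸ α B B B ▸ id ⊗₁ Δ B °))
      ≡⟨ cong (Δ A ▸_) frobenius-square ⟩
    Δ A ▸ (Δ A ⊗₁ id ▸ α A A A ▸ a ⊗₁ (a ⊗₁ k ▸ Δ B °))
      ≡⟨ sym (assoc (Δ A) (Δ A ⊗₁ id ▸ α A A A) _) ⟩
    Δ A ▸ (Δ A ⊗₁ id ▸ α A A A) ▸ a ⊗₁ (a ⊗₁ k ▸ Δ B °)
      ≡⟨ cong (_▸ a ⊗₁ (a ⊗₁ k ▸ Δ B °)) (trans (sym (assoc (Δ A) _ _)) (Δ-coassoc A)) ⟩
    Δ A ▸ id ⊗₁ Δ A ▸ a ⊗₁ (a ⊗₁ k ▸ Δ B °)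
      ≡⟨ assoc (Δ A) (id ⊗₁ Δ A) _ ⟩
    Δ A ▸ (id ⊗₁ Δ A ▸ a ⊗₁ (a ⊗₁ k ▸ Δ B °))
      ≡⟨ cong (Δ A ▸_) (sym (⊗-▸ id a (Δ A) _)) ⟩
    Δ A ▸ ((id ▸ a) ⊗₁ (Δ A ▸ (a ⊗₁ k ▸ Δ B °)))
      ≡⟨ cong (Δ A ▸_) (cong₂ _⊗₁_ (idˡ a) (sym (assoc (Δ A) (a ⊗₁ k) (Δ B °)))) ⟩
    Δ A ▸ a ⊗₁ (a ∩ k)                            ∎
    where
      copy-first : a ⊗₁ k ▸ Δ B ⊗₁ id ≡ Δ A ⊗₁ id ▸ (a ⊗₁ a) ⊗₁ k
      copy-first = begin
        a ⊗₁ k ▸ Δ B ⊗₁ id                ≡⟨ sym (⊗-▸ a (Δ B) k id) ⟩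
        (a ▸ Δ B) ⊗₁ (k ▸ id)             ≡⟨ cong₂ _⊗₁_ (Δ-nat a) (trans (idʳ k) (sym (idˡ k))) ⟩
        (Δ A ▸ a ⊗₁ a) ⊗₁ (id ▸ k)        ≡⟨ ⊗-▸ (Δ A) (a ⊗₁ a) id k ⟩
        Δ A ⊗₁ id ▸ (a ⊗₁ a) ⊗₁ k         ∎
      frobenius-square : a ⊗₁ k ▸ (Δ B ⊗₁ id ▸ α B B B ▸ id ⊗₁ Δ B °)
                       ≡ Δ A ⊗₁ id ▸ α A A A ▸ a ⊗₁ (a ⊗₁ k ▸ Δ B °)
      frobenius-square = begin
        a ⊗₁ k ▸ (Δ B ⊗₁ id ▸ α B B B ▸ id ⊗₁ Δ B °)
          ≡⟨ trans (sym (assoc (a ⊗₁ k) _ _)) (cong (_▸ id ⊗₁ Δ B °) (sym (assoc (a ⊗₁ k) _ _))) ⟩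
        a ⊗₁ k ▸ Δ B ⊗₁ id ▸ α B B B ▸ id ⊗₁ Δ B °
          ≡⟨ cong (λ z → z ▸ α B B B ▸ id ⊗₁ Δ B °) copy-first ⟩
        Δ A ⊗₁ id ▸ (a ⊗₁ a) ⊗₁ k ▸ α B B B ▸ id ⊗₁ Δ B °
          ≡⟨ cong (_▸ id ⊗₁ Δ B °) (assoc (Δ A ⊗₁ id) _ _) ⟩
        Δ A ⊗₁ id ▸ ((a ⊗₁ a) ⊗₁ k ▸ α B B B) ▸ id ⊗₁ Δ B °
          ≡⟨ cong (λ z → Δ A ⊗₁ id ▸ z ▸ id ⊗₁ Δ B °) (α-nat a a k) ⟩
        Δ A ⊗₁ id ▸ (α A A A ▸ a ⊗₁ (a ⊗₁ k)) ▸ id ⊗₁ Δ B °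
          ≡⟨ cong (_▸ id ⊗₁ Δ B °) (sym (assoc (Δ A ⊗₁ id) _ _)) ⟩
        Δ A ⊗₁ id ▸ α A A A ▸ a ⊗₁ (a ⊗₁ k) ▸ id ⊗₁ Δ B °
          ≡⟨ assoc (Δ A ⊗₁ id ▸ α A A A) _ _ ⟩
        Δ A ⊗₁ id ▸ α A A A ▸ (a ⊗₁ (a ⊗₁ k) ▸ id ⊗₁ Δ B °)
          ≡⟨ cong (Δ A ⊗₁ id ▸ α A A A ▸_) (trans (sym (⊗-▸ a id (a ⊗₁ k) (Δ B °)))
                                                   (cong (_⊗₁ (a ⊗₁ k ▸ Δ B °)) (idʳ a))) ⟩
        Δ A ⊗₁ id ▸ α A A A ▸ a ⊗₁ (a ⊗₁ k ▸ Δ B °) ∎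

  Δ-intertwining⇒square : ∀ {A} {t x : Hom A A} → t ▸ Δ A ≡ Δ A ▸ id ⊗₁ x → x ≡ t ▸ t
  Δ-intertwining⇒square {A} {t} {x} t▸Δ≡ = Δ-monic (begin
    x ▸ Δ A                   ≡⟨ Δ-nat x ⟩
    Δ A ▸ x ⊗₁ x              ≡⟨ cong (Δ A ▸_) (⊗-serialize₁₂ x x) ⟩
    Δ A ▸ (x ⊗₁ id ▸ id ⊗₁ x) ≡⟨ sym (assoc (Δ A) (x ⊗₁ id) (id ⊗₁ x)) ⟩
    Δ A ▸ x ⊗₁ id ▸ id ⊗₁ x   ≡⟨ cong (_▸ id ⊗₁ x) (sym (Δ▸⊗-swap t▸Δ≡)) ⟩
    t ▸ Δ A ▸ id ⊗₁ x         ≡⟨ assoc t (Δ A) (id ⊗₁ x) ⟩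
    t ▸ (Δ A ▸ id ⊗₁ x)       ≡⟨ cong (t ▸_) (sym t▸Δ≡) ⟩
    t ▸ (t ▸ Δ A)             ≡⟨ sym (assoc t t (Δ A)) ⟩
    t ▸ t ▸ Δ A               ∎)

  restr-id∩⇒idempotent : ∀ {A} {x : Hom A A} →
                         restr (id ∩ x) ≡ restr (Δ A ▸ id ⊗₁ x) → x ▸ x ≡ x
  restr-id∩⇒idempotent {A} {x} restr≡ = begin
    x ▸ x    ≡⟨ cong₂ _▸_ x≡t x≡t ⟩
    t ▸ t    ≡⟨ sym t≡t▸t ⟩
    t        ≡⟨ sym x≡t ⟩
    x        ∎
    where
      t = id ∩ x
      t≡t▸t : t ≡ t ▸ t
      t≡t▸t = Δ-intertwining⇒square (∩-▸-Δ id x)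
      t▸Δ≡ : t ▸ Δ A ≡ Δ A ▸ id ⊗₁ x
      t▸Δ≡ = begin
        Δ A ▸ id ⊗₁ x ▸ Δ A ° ▸ Δ A       ≡⟨ assoc (Δ A ▸ id ⊗₁ x) (Δ A °) (Δ A) ⟩
        Δ A ▸ id ⊗₁ x ▸ (Δ A ° ▸ Δ A)     ≡⟨ cong (Δ A ▸ id ⊗₁ x ▸_) (sym (restr-° (Δ A))) ⟩
        Δ A ▸ id ⊗₁ x ▸ restr (Δ A °)     ≡⟨ ▸-restr-absorb (Δ A ▸ id ⊗₁ x) (Δ A °) restr≡ ⟩
        Δ A ▸ id ⊗₁ x                     ∎
      x≡t : x ≡ t
      x≡t = trans (Δ-intertwining⇒square t▸Δ≡) (sym t≡t▸t)

module RestrictionFunctorProperties {o h o' h'} {X : DiscreteInverseCategory o h}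
         {Y : DiscreteInverseCategory o' h'} (F : RestrictionFunctor X Y)
         (P : PreservesInverseProducts F) where
  private
    module X = DiscreteInverseCategory X
    module Y = DiscreteInverseCategory Y
  open X
  open InverseCategoryProperties invCat
  open DiscreteInverseCategoryProperties X
  open RestrictionFunctor F
  open PreservesInverseProducts P

  F-▸-cong : ∀ {A B C} {a a' : Hom A B} {b b' : Hom B C} →
             F₁ a ≡ F₁ a' → F₁ b ≡ F₁ b' → F₁ (a ▸ b) ≡ F₁ (a' ▸ b')
  F-▸-cong {a = a} {a'} {b} {b'} Fa≡ Fb≡ =
    trans (F-▸ a b) (trans (cong₂ Y._▸_ Fa≡ Fb≡) (sym (F-▸ a' b')))

  F-⊗-cong : ∀ {A B C D} {a a' : Hom A B} {b b' : Hom C D} →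
             F₁ a ≡ F₁ a' → F₁ b ≡ F₁ b' → F₁ (a ⊗₁ b) ≡ F₁ (a' ⊗₁ b')
  F-⊗-cong {A} {B} {C} {D} {a} {a'} {b} {b'} Fa≡ Fb≡ =
    CategoryProperties.iso-cancelˡ Y.cat (φ-iso A C) (begin
      φ A C Y.▸ F₁ (a ⊗₁ b)            ≡⟨ sym (φ-nat a b) ⟩
      F₁ a Y.⊗₁ F₁ b Y.▸ φ B D         ≡⟨ cong (Y._▸ φ B D) (cong₂ Y._⊗₁_ Fa≡ Fb≡) ⟩
      F₁ a' Y.⊗₁ F₁ b' Y.▸ φ B D       ≡⟨ φ-nat a' b' ⟩
      φ A C Y.▸ F₁ (a' ⊗₁ b')          ∎)

  module _ (faithfulOnRI : FaithfulOnRestrictionIdempotents F) where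

    restr-reflect : ∀ {A B} {c d : Hom A B} → F₁ c ≡ F₁ d → restr c ≡ restr d
    restr-reflect {c = c} {d} Fc≡Fd =
      faithfulOnRI (restr c) (restr d)
        (restr-isRestrictionIdempotent c) (restr-isRestrictionIdempotent d)
        (trans (F-restr c) (trans (cong Y.restr Fc≡Fd) (sym (F-restr d))))

    faithfulOnRestrictionIdempotents⇒faithful : Faithful F
    faithfulOnRestrictionIdempotents⇒faithful {A} f g Ff≡Fg =
      ≡-from-▸° x≡e (restr-reflect (sym Ff≡Fg))
      where
        e = restr f
        x = g ▸ f °
        Fx≡Fe : F₁ x ≡ F₁ e
        Fx≡Fe = F-▸-cong (sym Ff≡Fg) refl
        restr-Δ▸id⊗e : restr (Δ A ▸ id ⊗₁ e) ≡ id ∩ e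
        restr-Δ▸id⊗e = trans (restr-Δ▸⊗ id e)
          (cong₂ (λ u v → Δ A ▸ u ⊗₁ v ▸ Δ A °) restr-id (sym (restr-isRestrictionIdempotent f)))
        restr-id∩x : restr (id ∩ x) ≡ restr (Δ A ▸ id ⊗₁ x)
        restr-id∩x = begin
          restr (id ∩ x)                 ≡⟨ restr-reflect (F-▸-cong (F-▸-cong refl (F-⊗-cong refl Fx≡Fe)) refl) ⟩
          restr (id ∩ e)                 ≡⟨ cong restr (sym restr-Δ▸id⊗e) ⟩
          restr (restr (Δ A ▸ id ⊗₁ e))  ≡⟨ sym (restr-isRestrictionIdempotent _) ⟩
          restr (Δ A ▸ id ⊗₁ e)          ≡⟨ restr-reflect (F-▸-cong refl (F-⊗-cong refl (sym Fx≡Fe))) ⟩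
          restr (Δ A ▸ id ⊗₁ x)          ∎
        x≡e : x ≡ e
        x≡e = faithfulOnRI x e
          (idempotent⇒restrictionIdempotent (restr-id∩⇒idempotent restr-id∩x))
          (restr-isRestrictionIdempotent f) Fx≡Fe

mainTheorem10 : ∀ {o h o' h' : Level} {X : DiscreteInverseCategory o h}
    {Y : DiscreteInverseCategory o' h'} (F : RestrictionFunctor X Y) →
    PreservesInverseProducts F →
    (Faithful F ⇔ FaithfulOnRestrictionIdempotents F)
mainTheorem10 F P = mk⇔ (λ faithful {_} e e' _ _ → faithful e e')
  (RestrictionFunctorProperties.faithfulOnRestrictionIdempotents⇒faithful F P)
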